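{- Let $a_1,a_2$ be coprime positive integers, let $m$ be a positive integer, and write $g_j=g_j(a_1,a_2,ma_1a_2)$ for integers $j\ge0$. Let $j\ge 0$ and suppose $g_j\neq 0$. Then: (i) if $j<m+1$, then $g_j=(j+1)a_1a_2-a_1-a_2$; (ii) $g_{m+1}=0$; (iii) $g_{m+2}=(m+2)a_1a_2-a_1-a_2$.
   Context: A representation of an integer $M$ by a triple $(b_1,b_2,b_3)$ of positive integers is a solution $(x_1,x_2,x_3)\in\mathbb{Z}_{\ge0}^3$ of $M=b_1x_1+b_2x_2+b_3x_3$. For relatively prime positive integers $b_1,b_2,b_3$ and an integer $j\ge0$, $g_j(b_1,b_2,b_3)$ is the greatest integer $M$ having exactly $j$ representations by $(b_1,b_2,b_3)$, if such a positive integer exists, and $g_j(b_1,b_2,b_3)=0$ otherwise. -}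

module Defs where

open import Data.Nat as ℕ using (ℕ; zero; suc; _+_; _*_)
open import Data.Integer as ℤ using (ℤ; +_; -[1+_])
open import Data.List using (List; []; _∷_; length; filter; upTo; concatMap; map)
open import Data.Product using (_×_; _,_)
open import Data.Sum using (_⊎_)
open import Relation.Binary.PropositionalEquality using (_≡_)
open import Relation.Nullary using (¬_)

triplesUpTo : ℕ → List (ℕ × ℕ × ℕ)
triplesUpTo N =
  concatMap (λ x → concatMap (λ y → map (λ z → x , y , z) (upTo (suc N))) (upTo (suc N))) (upTo (suc N))

-- For positive bᵢ every such
-- solution has xᵢ ≤ M, so enumerating triples in [0,M]³ counts all of them.
repsℕ : ℕ → ℕ → ℕ → ℕ → ℕ
repsℕ b₁ b₂ b₃ M =
  length (filter (λ { (x₁ , x₂ , x₃) → (b₁ * x₁ + b₂ * x₂ + b₃ * x₃) ℕ.≟ M }) (triplesUpTo M))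

reps : ℕ → ℕ → ℕ → ℤ → ℕ
reps b₁ b₂ b₃ (+ M)     = repsℕ b₁ b₂ b₃ M
reps b₁ b₂ b₃ -[1+ _ ]  = 0

IsG : ℕ → ℕ → ℕ → ℕ → ℤ → Set
IsG b₁ b₂ b₃ j g =
  (ℤ.+0 ℤ.< g × reps b₁ b₂ b₃ g ≡ j × (∀ M → reps b₁ b₂ b₃ M ≡ j → M ℤ.≤ g))
  ⊎ (g ≡ ℤ.+0 × (∀ M → ℤ.+0 ℤ.< M → ¬ (reps b₁ b₂ b₃ M ≡ j)))

{-# OPTIONS --safe #-}
module Submission where

-- Write P = a₁a₂, L = mP, r(n) for the number of representations of n by (a₁, a₂) and N(M)
-- for the number by (a₁, a₂, L). Sorting representations by their last coordinate gives
-- N(M) = r(M) for M < L and N(M + L) = r(M + L) + N(M). By coprimality each residue class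
-- modulo a₂ meets [0, a₂) exactly once, so r(n + P) = r(n) + 1, r(n) ≤ 1 for n < P,
-- r(n) ≥ 1 for n > P - a₁ - a₂ and r(P - a₁ - a₂) = 0. Hence r(n) = k when
-- n + a₁ + a₂ = (k + 1)P and r(n) > k when n + a₁ + a₂ > (k + 1)P. Since r(M + L) = m + r(M),
-- N agrees with r wherever r ≤ m, which gives (i). For M ≥ L, N(M) = m + r(M - L) + N(M - L)
-- is m when r(M - L) = 0 and at least m + 2 otherwise, while N ≤ m below L, so (ii) holds;
-- at n = (m + 2)P - a₁ - a₂ one finds N(n) = (m + 1) + 1, and N(M) ≥ m + 3 beyond it, giving (iii).

open import Defs
open import Data.Nat
open import Data.Nat.Properties
open import Data.Nat.Divisibility using (_∣_; divides; _∣?_; ∣m+n∣m⇒∣n; ∣⇒≤)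
open import Data.Nat.DivMod using (_%_; _/_; m%n<n; m≡m%n+[m/n]*n)
open import Data.Nat.GCD using (module Bézout)
open import Data.Nat.Coprimality as Cop using (Coprime; coprime-Bézout; coprime-divisor)
open import Data.Nat.Tactic.RingSolver using (solve-∀)
open import Data.List using (List; _∷_; _++_; length; filter; concatMap; map; applyUpTo)
open import Data.List.Properties using (filter-++; length-++; map-applyUpTo)
open import Data.Sum using (_⊎_; inj₁; inj₂)
open import Algebra.Properties.CommutativeSemigroup +-commutativeSemigroup using (interchange)
open import Data.Product using (_×_; _,_; ∃-syntax)
open import Function using (id; _∘_; _⇔_; mk⇔; Equivalence)
open import Relation.Nullary using (Dec; yes; no; ¬_; contradiction)
open import Relation.Binary.PropositionalEquality

m+n≤m*n+1 : ∀ m n .{{_ : NonZero m}} .{{_ : NonZero n}} → m + n ≤ m * n + 1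
m+n≤m*n+1 (suc p) (suc q) = ≤-trans (m≤m+n (suc p + suc q) (p * q)) (≤-reflexive (expand p q))
  where
  expand : ∀ p q → suc p + suc q + p * q ≡ suc p * suc q + 1
  expand = solve-∀

m≤n⇒∃[o]n≡o+m : ∀ {m n} → m ≤ n → ∃[ o ] n ≡ o + m
m≤n⇒∃[o]n≡o+m {m} m≤n with m≤n⇒∃[o]m+o≡n m≤n
... | o , m+o≡n = o , trans (sym m+o≡n) (+-comm m o)

∑ : ℕ → (ℕ → ℕ) → ℕ
∑ zero    f = 0
∑ (suc n) f = ∑ n f + f n

∑-cong : ∀ n {f g : ℕ → ℕ} → (∀ i → i < n → f i ≡ g i) → ∑ n f ≡ ∑ n g
∑-cong zero    f≡g = refl
∑-cong (suc n) f≡g = cong₂ _+_ (∑-cong n (λ i i<n → f≡g i (m<n⇒m<1+n i<n))) (f≡g n ≤-refl)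

∑-unfoldˡ : ∀ n (f : ℕ → ℕ) → ∑ (suc n) f ≡ f 0 + ∑ n (f ∘ suc)
∑-unfoldˡ zero    f = +-comm 0 (f 0)
∑-unfoldˡ (suc n) f = trans (cong (_+ f (suc n)) (∑-unfoldˡ n f)) (+-assoc (f 0) _ _)

∑-≡0 : ∀ n {f : ℕ → ℕ} → (∀ i → i < n → f i ≡ 0) → ∑ n f ≡ 0
∑-≡0 n f≡0 = trans (∑-cong n f≡0) (∑-const0 n)
  where
  ∑-const0 : ∀ n → ∑ n (λ _ → 0) ≡ 0
  ∑-const0 zero    = refl
  ∑-const0 (suc n) = trans (+-identityʳ _) (∑-const0 n)

∑-extend : ∀ {k n} (f : ℕ → ℕ) → k ≤ n → (∀ i → k ≤ i → f i ≡ 0) → ∑ n f ≡ ∑ k f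
∑-extend {n = zero}  f z≤n    _    = refl
∑-extend {k} {suc n} f k≤1+n f≡0 with m≤n⇒m<n∨m≡n k≤1+n
... | inj₂ refl = refl
... | inj₁ k<1+n = trans (cong₂ _+_ (∑-extend f (s≤s⁻¹ k<1+n) f≡0) (f≡0 n (s≤s⁻¹ k<1+n))) (+-identityʳ _)

∑-split : ∀ k n (f : ℕ → ℕ) → ∑ (k + n) f ≡ ∑ k f + ∑ n (λ i → f (k + i))
∑-split k zero    f = trans (cong (λ l → ∑ l f) (+-identityʳ k)) (sym (+-identityʳ _))
∑-split k (suc n) f rewrite +-suc k n = trans (cong (_+ f (k + n)) (∑-split k n f)) (+-assoc (∑ k f) _ _)

∑-distrib-+ : ∀ n (f g : ℕ → ℕ) → ∑ n (λ i → f i + g i) ≡ ∑ n f + ∑ n g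
∑-distrib-+ zero    f g = refl
∑-distrib-+ (suc n) f g = trans (cong (_+ (f n + g n)) (∑-distrib-+ n f g)) (interchange (∑ n f) (∑ n g) (f n) (g n))

∑-comm : ∀ m n (f : ℕ → ℕ → ℕ) → ∑ m (λ i → ∑ n (f i)) ≡ ∑ n (λ j → ∑ m (λ i → f i j))
∑-comm m zero    f = ∑-≡0 m (λ _ _ → refl)
∑-comm m (suc n) f = trans (∑-distrib-+ m (λ i → ∑ n (f i)) (λ i → f i n))
                           (cong (_+ ∑ m (λ i → f i n)) (∑-comm m n f))

𝟙 : {P : Set} → Dec P → ℕ
𝟙 (yes _) = 1
𝟙 (no _)  = 0

𝟙-yes : {P : Set} (p? : Dec P) → P → 𝟙 p? ≡ 1
𝟙-yes (yes _) _ = refl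
𝟙-yes (no ¬p) p = contradiction p ¬p

𝟙-no : {P : Set} (p? : Dec P) → ¬ P → 𝟙 p? ≡ 0
𝟙-no (yes p) ¬p = contradiction p ¬p
𝟙-no (no _)  _  = refl

𝟙-cong : {P Q : Set} (p? : Dec P) (q? : Dec Q) → P ⇔ Q → 𝟙 p? ≡ 𝟙 q?
𝟙-cong p? (yes q) P⇔Q = 𝟙-yes p? (Equivalence.from P⇔Q q)
𝟙-cong p? (no ¬q) P⇔Q = 𝟙-no p? (¬q ∘ Equivalence.to P⇔Q)

module _ {P : ℕ → Set} (P? : ∀ i → Dec (P i)) where

  ∑𝟙-none : ∀ n → (∀ i → i < n → ¬ P i) → ∑ n (𝟙 ∘ P?) ≡ 0
  ∑𝟙-none n ¬P = ∑-≡0 n (λ i i<n → 𝟙-no (P? i) (¬P i i<n))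

  ∑𝟙-pos : ∀ n {k} → k < n → P k → 1 ≤ ∑ n (𝟙 ∘ P?)
  ∑𝟙-pos (suc n) {k} k<1+n Pk with m≤n⇒m<n∨m≡n (s≤s⁻¹ k<1+n)
  ... | inj₁ k<n  = ≤-trans (∑𝟙-pos n k<n Pk) (m≤m+n _ _)
  ... | inj₂ refl = ≤-trans (≤-reflexive (sym (𝟙-yes (P? k) Pk))) (m≤n+m _ _)

  ∑𝟙-≤1 : ∀ n → (∀ i j → i < n → j < n → P i → P j → i ≡ j) → ∑ n (𝟙 ∘ P?) ≤ 1
  ∑𝟙-≤1 zero    _   = z≤n
  ∑𝟙-≤1 (suc n) inj with P? n
  ... | no _   = ≤-trans (≤-reflexive (+-identityʳ _))
                   (∑𝟙-≤1 n (λ i j i<n j<n → inj i j (m<n⇒m<1+n i<n) (m<n⇒m<1+n j<n)))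
  ... | yes Pn = ≤-reflexive (cong (_+ 1) (∑𝟙-none n λ i i<n Pi →
                   <-irrefl (inj i n (m<n⇒m<1+n i<n) ≤-refl Pi Pn) i<n))

  ∑𝟙-unique : ∀ n {k} → k < n → P k → (∀ i → i < n → P i → i ≡ k) → ∑ n (𝟙 ∘ P?) ≡ 1
  ∑𝟙-unique n k<n Pk unique = ≤-antisym
    (∑𝟙-≤1 n (λ i j i<n j<n Pi Pj → trans (unique i i<n Pi) (sym (unique j j<n Pj))))
    (∑𝟙-pos n k<n Pk)

module _ {A : Set} {P : A → Set} (P? : ∀ x → Dec (P x)) where

  length-filter-∷ : ∀ x xs → length (filter P? (x ∷ xs)) ≡ 𝟙 (P? x) + length (filter P? xs)
  length-filter-∷ x xs with P? x
  ... | yes _ = refl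
  ... | no _  = refl

  length-filter-applyUpTo : ∀ n (g : ℕ → A) → length (filter P? (applyUpTo g n)) ≡ ∑ n (𝟙 ∘ P? ∘ g)
  length-filter-applyUpTo zero    g = refl
  length-filter-applyUpTo (suc n) g = begin
    length (filter P? (g 0 ∷ applyUpTo (g ∘ suc) n))          ≡⟨ length-filter-∷ (g 0) _ ⟩
    𝟙 (P? (g 0)) + length (filter P? (applyUpTo (g ∘ suc) n))
      ≡⟨ cong (𝟙 (P? (g 0)) +_) (length-filter-applyUpTo n (g ∘ suc)) ⟩
    𝟙 (P? (g 0)) + ∑ n (𝟙 ∘ P? ∘ g ∘ suc)                     ≡⟨ ∑-unfoldˡ n (𝟙 ∘ P? ∘ g) ⟨
    ∑ (suc n) (𝟙 ∘ P? ∘ g)                                    ∎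
    where open ≡-Reasoning

  length-filter-concatMap : ∀ {B : Set} (F : B → List A) n (g : ℕ → B) →
    length (filter P? (concatMap F (applyUpTo g n))) ≡ ∑ n (λ i → length (filter P? (F (g i))))
  length-filter-concatMap F zero    g = refl
  length-filter-concatMap F (suc n) g = begin
    length (filter P? (F (g 0) ++ concatMap F (applyUpTo (g ∘ suc) n)))
      ≡⟨ cong length (filter-++ P? (F (g 0)) _) ⟩
    length (filter P? (F (g 0)) ++ filter P? (concatMap F (applyUpTo (g ∘ suc) n)))
      ≡⟨ length-++ (filter P? (F (g 0))) ⟩
    length (filter P? (F (g 0))) + length (filter P? (concatMap F (applyUpTo (g ∘ suc) n)))
      ≡⟨ cong (length (filter P? (F (g 0))) +_) (length-filter-concatMap F n (g ∘ suc)) ⟩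
    length (filter P? (F (g 0))) + ∑ n (λ i → length (filter P? (F (g (suc i)))))
      ≡⟨ ∑-unfoldˡ n (λ i → length (filter P? (F (g i)))) ⟨
    ∑ (suc n) (λ i → length (filter P? (F (g i)))) ∎
    where open ≡-Reasoning

repsℕ-∑ : ∀ b₁ b₂ b₃ M → repsℕ b₁ b₂ b₃ M ≡
  ∑ (suc M) λ x → ∑ (suc M) λ y → ∑ (suc M) λ z → 𝟙 (b₁ * x + b₂ * y + b₃ * z ≟ M)
repsℕ-∑ b₁ b₂ b₃ M =
  trans (length-filter-concatMap P? xLayer (suc M) id) (∑-cong (suc M) λ x _ →
  trans (length-filter-concatMap P? (yLayer x) (suc M) id) (∑-cong (suc M) λ y _ →
  trans (cong (length ∘ filter P?) (map-applyUpTo id (triple x y) (suc M)))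
        (length-filter-applyUpTo P? (suc M) (triple x y))))
  where
  P? : (t : ℕ × ℕ × ℕ) → Dec _
  P? (x , y , z) = b₁ * x + b₂ * y + b₃ * z ≟ M
  triple : ℕ → ℕ → ℕ → ℕ × ℕ × ℕ
  triple x y z = x , y , z
  yLayer : ℕ → ℕ → List (ℕ × ℕ × ℕ)
  yLayer x y = map (triple x y) (applyUpTo id (suc M))
  xLayer : ℕ → List (ℕ × ℕ × ℕ)
  xLayer x = concatMap (yLayer x) (applyUpTo id (suc M))

infix 4 _≼[_]_ _≼[_]?_

record _≼[_]_ (k b n : ℕ) : Set where
  constructor by-multiple
  field
    multiplier : ℕ
    equation   : b * multiplier + k ≡ n

≼⇒≤ : ∀ {k b n} → k ≼[ b ] n → k ≤ n
≼⇒≤ {k} {b} (by-multiple y eq) = ≤-trans (m≤n+m k (b * y)) (≤-reflexive eq)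

_≼[_]?_ : ∀ k b n → Dec (k ≼[ b ] n)
k ≼[ b ]? n with k ≤? n
... | no k≰n = no (k≰n ∘ ≼⇒≤)
... | yes k≤n with b ∣? (n ∸ k)
...   | yes (divides y eq) = yes (by-multiple y (trans (cong (_+ k) (trans (*-comm b y) (sym eq))) (m∸n+n≡m k≤n)))
...   | no b∤n∸k = no λ (by-multiple y eq) →
          b∤n∸k (divides y (trans (cong (_∸ k) (sym eq)) (trans (m+n∸n≡m (b * y) k) (*-comm b y))))

≼-+ʳ : ∀ {k b n} d → k + d ≼[ b ] n + d ⇔ k ≼[ b ] n
≼-+ʳ {k} {b} {n} d = mk⇔
  (λ (by-multiple y eq) → by-multiple y (+-cancelʳ-≡ d _ _ (trans (+-assoc (b * y) k d) eq)))
  (λ (by-multiple y eq) → by-multiple y (trans (sym (+-assoc (b * y) k d)) (cong (_+ d) eq)))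

-- The number of representations of n by (a, b): each x ≤ n admits at most one y with a x + b y = n.
reps₂ : ℕ → ℕ → ℕ → ℕ
reps₂ a b n = ∑ (suc n) λ x → 𝟙 (a * x ≼[ b ]? n)

module ThreeGenerators (a b c : ℕ) .{{_ : NonZero a}} .{{_ : NonZero b}} .{{_ : NonZero c}} where

  layer : ℕ → ℕ → ℕ
  layer M z = ∑ (suc M) λ x → 𝟙 (z * c + a * x ≼[ b ]? M)

  ∑𝟙[b*y+k≡M]≡𝟙[k≼M] : ∀ M k → ∑ (suc M) (λ y → 𝟙 (b * y + k ≟ M)) ≡ 𝟙 (k ≼[ b ]? M)
  ∑𝟙[b*y+k≡M]≡𝟙[k≼M] M k with k ≼[ b ]? M
  ... | no ¬sol       = ∑𝟙-none (λ y → b * y + k ≟ M) (suc M) (λ y _ eq → ¬sol (by-multiple y eq))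
  ... | yes (by-multiple y₀ eq) = ∑𝟙-unique (λ y → b * y + k ≟ M) (suc M) y₀<1+M eq
      (λ y _ eq′ → *-cancelˡ-≡ y y₀ b (+-cancelʳ-≡ k _ _ (trans eq′ (sym eq))))
    where
    y₀<1+M : y₀ < suc M
    y₀<1+M = s≤s (≤-trans (m≤n*m y₀ b) (≤-trans (m≤m+n (b * y₀) k) (≤-reflexive eq)))

  repsℕ-layers : ∀ M → repsℕ a b c M ≡ ∑ (suc M) (layer M)
  repsℕ-layers M = begin
    repsℕ a b c M
      ≡⟨ repsℕ-∑ a b c M ⟩
    ∑ (suc M) (λ x → ∑ (suc M) λ y → ∑ (suc M) λ z → 𝟙 (a * x + b * y + c * z ≟ M))
      ≡⟨ ∑-cong (suc M) (λ x _ → ∑-comm (suc M) (suc M) _) ⟩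
    ∑ (suc M) (λ x → ∑ (suc M) λ z → ∑ (suc M) λ y → 𝟙 (a * x + b * y + c * z ≟ M))
      ≡⟨ ∑-cong (suc M) (λ x _ → ∑-cong (suc M) λ z _ → ∑-cong (suc M) λ y _ →
           cong (λ w → 𝟙 (w ≟ M)) (rearrange a b c x y z)) ⟩
    ∑ (suc M) (λ x → ∑ (suc M) λ z → ∑ (suc M) λ y → 𝟙 (b * y + (z * c + a * x) ≟ M))
      ≡⟨ ∑-cong (suc M) (λ x _ → ∑-cong (suc M) λ z _ → ∑𝟙[b*y+k≡M]≡𝟙[k≼M] M (z * c + a * x)) ⟩
    ∑ (suc M) (λ x → ∑ (suc M) λ z → 𝟙 (z * c + a * x ≼[ b ]? M))
      ≡⟨ ∑-comm (suc M) (suc M) _ ⟩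
    ∑ (suc M) (layer M) ∎
    where
    open ≡-Reasoning
    rearrange : ∀ a b c x y z → a * x + b * y + c * z ≡ b * y + (z * c + a * x)
    rearrange = solve-∀

  layer-vanishes : ∀ {M} z → M < z * c → layer M z ≡ 0
  layer-vanishes {M} z M<zc = ∑𝟙-none (λ x → z * c + a * x ≼[ b ]? M) (suc M) λ x _ sol →
    <⇒≱ M<zc (≤-trans (m≤m+n (z * c) (a * x)) (≼⇒≤ sol))

  layer-shift : ∀ M z → layer (M + c) (suc z) ≡ layer M z
  layer-shift M z = begin
    ∑ (suc (M + c)) (λ x → 𝟙 (c + z * c + a * x ≼[ b ]? M + c))
      ≡⟨ ∑-cong (suc (M + c)) (λ x _ → 𝟙-cong _ _ (shifted x)) ⟩
    ∑ (suc (M + c)) (λ x → 𝟙 (z * c + a * x ≼[ b ]? M))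
      ≡⟨ ∑-extend _ (s≤s (m≤m+n M c)) (λ x M<x → 𝟙-no _ (λ sol → <⇒≱ M<x (too-big x sol))) ⟩
    layer M z ∎
    where
    open ≡-Reasoning
    shifted : ∀ x → c + z * c + a * x ≼[ b ] M + c ⇔ z * c + a * x ≼[ b ] M
    shifted x = subst (λ k → k ≼[ b ] M + c ⇔ z * c + a * x ≼[ b ] M)
      (move-c a c x z) (≼-+ʳ c)
      where
      move-c : ∀ a c x z → z * c + a * x + c ≡ c + z * c + a * x
      move-c = solve-∀
    too-big : ∀ x → z * c + a * x ≼[ b ] M → x ≤ M
    too-big x sol = ≤-trans (m≤n*m x a) (≤-trans (m≤n+m (a * x) (z * c)) (≼⇒≤ sol))

  repsℕ-below : ∀ {M} → M < c → repsℕ a b c M ≡ reps₂ a b M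
  repsℕ-below {M} M<c = begin
    repsℕ a b c M                             ≡⟨ repsℕ-layers M ⟩
    ∑ (suc M) (layer M)                       ≡⟨ ∑-unfoldˡ M (layer M) ⟩
    reps₂ a b M + ∑ M (layer M ∘ suc)         ≡⟨ cong (reps₂ a b M +_) (∑-≡0 M λ z _ →
                                                   layer-vanishes (suc z) (<-≤-trans M<c (m≤n*m c (suc z)))) ⟩
    reps₂ a b M + 0                           ≡⟨ +-identityʳ _ ⟩
    reps₂ a b M                               ∎
    where open ≡-Reasoning

  repsℕ-step : ∀ M → repsℕ a b c (M + c) ≡ reps₂ a b (M + c) + repsℕ a b c M
  repsℕ-step M = begin
    repsℕ a b c (M + c)                               ≡⟨ repsℕ-layers (M + c) ⟩
    ∑ (suc (M + c)) (layer (M + c))                   ≡⟨ ∑-unfoldˡ (M + c) (layer (M + c)) ⟩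
    reps₂ a b (M + c) + ∑ (M + c) (layer (M + c) ∘ suc)
      ≡⟨ cong (reps₂ a b (M + c) +_) (∑-cong (M + c) λ z _ → layer-shift M z) ⟩
    reps₂ a b (M + c) + ∑ (M + c) (layer M)
      ≡⟨ cong (reps₂ a b (M + c) +_) (∑-extend (layer M) (m<m+n M (>-nonZero⁻¹ c)) λ z M<z →
           layer-vanishes z (<-≤-trans M<z (m≤m*n z c))) ⟩
    reps₂ a b (M + c) + ∑ (suc M) (layer M)           ≡⟨ cong (reps₂ a b (M + c) +_) (repsℕ-layers M) ⟨
    reps₂ a b (M + c) + repsℕ a b c M                 ∎
    where open ≡-Reasoning

infix 4 _≡_[mod_]

record _≡_[mod_] (k n b : ℕ) : Set where
  constructor by-multiples
  field
    multiplierˡ multiplierʳ : ℕ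
    equation               : k + b * multiplierˡ ≡ n + b * multiplierʳ

≡-mod-sym : ∀ {k n b} → k ≡ n [mod b ] → n ≡ k [mod b ]
≡-mod-sym (by-multiples s w eq) = by-multiples w s (sym eq)

≡-mod-trans : ∀ {k n p b} → k ≡ n [mod b ] → n ≡ p [mod b ] → k ≡ p [mod b ]
≡-mod-trans {k} {n} {p} {b} (by-multiples s₁ w₁ eq₁) (by-multiples s₂ w₂ eq₂) =
  by-multiples (s₁ + s₂) (w₂ + w₁) (begin
  k + b * (s₁ + s₂)   ≡⟨ regroup k b s₁ s₂ ⟩
  k + b * s₁ + b * s₂ ≡⟨ cong (_+ b * s₂) eq₁ ⟩
  n + b * w₁ + b * s₂ ≡⟨ +-swap n b w₁ s₂ ⟩
  n + b * s₂ + b * w₁ ≡⟨ cong (_+ b * w₁) eq₂ ⟩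
  p + b * w₂ + b * w₁ ≡⟨ regroup p b w₂ w₁ ⟨
  p + b * (w₂ + w₁)   ∎)
  where
  open ≡-Reasoning
  regroup : ∀ k b s t → k + b * (s + t) ≡ k + b * s + b * t
  regroup = solve-∀
  +-swap : ∀ n b w s → n + b * w + b * s ≡ n + b * s + b * w
  +-swap = solve-∀

≼⇒≡-mod : ∀ {k b n} → k ≼[ b ] n → k ≡ n [mod b ]
≼⇒≡-mod {k} {b} {n} (by-multiple y eq) = by-multiples y 0 (begin
  k + b * y ≡⟨ +-comm k (b * y) ⟩
  b * y + k ≡⟨ eq ⟩
  n         ≡⟨ +-identityʳ n ⟨
  n + 0     ≡⟨ cong (n +_) (*-zeroʳ b) ⟨
  n + b * 0 ∎)
  where open ≡-Reasoning

≡-mod⇒≼⊎+≤ : ∀ {k n b} → k ≡ n [mod b ] → k ≼[ b ] n ⊎ n + b ≤ k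
≡-mod⇒≼⊎+≤ {k} {n} {b} (by-multiples s w eq) with w ≤? s
... | yes w≤s with m≤n⇒∃[o]m+o≡n w≤s
...   | t , refl = inj₁ (by-multiple t (+-cancelʳ-≡ (b * w) _ _ (trans (shuffle k b w t) eq)))
  where
  shuffle : ∀ k b w t → b * t + k + b * w ≡ k + b * (w + t)
  shuffle = solve-∀
≡-mod⇒≼⊎+≤ {k} {n} {b} (by-multiples s w eq) | no w≰s with m≤n⇒∃[o]m+o≡n (≰⇒> w≰s)
...   | t , refl = inj₂ (≤-trans (+-monoʳ-≤ n (m≤m*n b (suc t)))
                         (≤-reflexive (+-cancelʳ-≡ (b * s) _ _ (trans (shuffle n b s t) (sym eq)))))
  where
  shuffle : ∀ n b s t → n + b * suc t + b * s ≡ n + b * (suc s + t)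
  shuffle = solve-∀

≡-mod-≤⇒≼ : ∀ {k n b} .{{_ : NonZero b}} → k ≡ n [mod b ] → k ≤ n → k ≼[ b ] n
≡-mod-≤⇒≼ {k} {n} {b} k≡n k≤n with ≡-mod⇒≼⊎+≤ k≡n
... | inj₁ sol  = sol
... | inj₂ n+b≤k = contradiction (≤-trans n+b≤k k≤n) (<⇒≱ (m<m+n n (>-nonZero⁻¹ b)))

bézout-residue : ∀ {a b} .{{_ : NonZero b}} n → Bézout.Identity 1 a b → ∃[ X ] a * X ≡ n [mod b ]
bézout-residue {a} {suc p} n (Bézout.+- u v eq) = u * n , by-multiples 0 (v * n) (begin
  a * (u * n) + suc p * 0 ≡⟨ lhs a u n (suc p) ⟩
  (u * a) * n             ≡⟨ cong (_* n) eq ⟨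
  (1 + v * suc p) * n     ≡⟨ rhs v n (suc p) ⟩
  n + suc p * (v * n)     ∎)
  where
  open ≡-Reasoning
  lhs : ∀ a u n b → a * (u * n) + b * 0 ≡ (u * a) * n
  lhs = solve-∀
  rhs : ∀ v n b → (1 + v * b) * n ≡ n + b * (v * n)
  rhs = solve-∀
bézout-residue {a} {suc p} n (Bézout.-+ u v eq) = u * n * p , by-multiples n (v * n * p) (begin
  a * (u * n * p) + suc p * n ≡⟨ lhs a u n p ⟩
  n + p * n * (1 + u * a)     ≡⟨ cong (λ k → n + p * n * k) eq ⟩
  n + p * n * (v * suc p)     ≡⟨ rhs v n p ⟩
  n + suc p * (v * n * p)     ∎)
  where
  open ≡-Reasoning
  lhs : ∀ a u n p → a * (u * n * p) + suc p * n ≡ n + p * n * (1 + u * a)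
  lhs = solve-∀
  rhs : ∀ v n p → n + p * n * (v * suc p) ≡ n + suc p * (v * n * p)
  rhs = solve-∀

m*[n%o]≡m*n[mod] : ∀ a {b} .{{_ : NonZero b}} X → a * (X % b) ≡ a * X [mod b ]
m*[n%o]≡m*n[mod] a {b} X = by-multiples (a * (X / b)) 0 (begin
  a * (X % b) + b * (a * (X / b)) ≡⟨ regroup a b (X % b) (X / b) ⟩
  a * (X % b + X / b * b)         ≡⟨ cong (a *_) (m≡m%n+[m/n]*n X b) ⟨
  a * X                           ≡⟨ +-identityʳ (a * X) ⟨
  a * X + 0                       ≡⟨ cong (a * X +_) (*-zeroʳ b) ⟨
  a * X + b * 0                   ∎)
  where
  open ≡-Reasoning
  regroup : ∀ a b r q → a * r + b * (a * q) ≡ a * (r + q * b)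
  regroup = solve-∀

module _ {a b : ℕ} .{{_ : NonZero b}} (coprime : Coprime a b) where

  -- Opaque, so that matching on a residue does not make Agda evaluate the Bézout coefficients.
  opaque
    coprime-residue : ∀ n → ∃[ x ] x < b × a * x ≡ n [mod b ]
    coprime-residue n with bézout-residue n (coprime-Bézout coprime)
    ... | X , X≡n = X % b , m%n<n X b , ≡-mod-trans (m*[n%o]≡m*n[mod] a X) X≡n

  private
    coprime-cancel-mod-≤ : ∀ {x x′} → x ≤ x′ → x′ < b → a * x ≡ a * x′ [mod b ] → x ≡ x′
    coprime-cancel-mod-≤ {x} x≤x′ x′<b (by-multiples s w eq) with m≤n⇒∃[o]m+o≡n x≤x′
    ... | zero  , refl = sym (+-identityʳ x)
    ... | suc d , refl = contradiction (≤-<-trans (≤-trans b≤d (m≤n+m (suc d) x)) x′<b) (<-irrefl refl)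
      where
      shuffle : ∀ a x d b w → a * (x + d) + b * w ≡ a * x + (b * w + a * d)
      shuffle = solve-∀
      b∣ad : b ∣ a * suc d
      b∣ad = ∣m+n∣m⇒∣n (subst (b ∣_) (+-cancelˡ-≡ (a * x) _ _ (trans eq (shuffle a x (suc d) b w)))
                          (divides s (*-comm b s)))
                        (divides w (*-comm b w))
      b≤d : b ≤ suc d
      b≤d = ∣⇒≤ (coprime-divisor (Cop.sym coprime) b∣ad)

  coprime-cancel-mod : ∀ {x x′} → x < b → x′ < b → a * x ≡ a * x′ [mod b ] → x ≡ x′
  coprime-cancel-mod {x} {x′} x<b x′<b ax≡ax′ with ≤-total x x′
  ... | inj₁ x≤x′ = coprime-cancel-mod-≤ x≤x′ x′<b ax≡ax′
  ... | inj₂ x′≤x = sym (coprime-cancel-mod-≤ x′≤x x<b (≡-mod-sym ax≡ax′))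

module TwoGenerators (a b : ℕ) .{{_ : NonZero a}} .{{_ : NonZero b}} (coprime : Coprime a b) where

  instance
    ab≢0 : NonZero (a * b)
    ab≢0 = m*n≢0 a b

  ∑<b-solvable≡1 : ∀ N → a * b ≤ N → ∑ b (λ x → 𝟙 (a * x ≼[ b ]? N)) ≡ 1
  ∑<b-solvable≡1 N ab≤N with coprime-residue coprime N
  ... | x₀ , x₀<b , ax₀≡N = ∑𝟙-unique (λ x → a * x ≼[ b ]? N) b x₀<b
          (≡-mod-≤⇒≼ ax₀≡N (≤-trans (<⇒≤ (*-monoʳ-< a x₀<b)) ab≤N))
          (λ x x<b sol → coprime-cancel-mod coprime x<b x₀<b (≡-mod-trans (≼⇒≡-mod sol) (≡-mod-sym ax₀≡N)))

  n+ab<a*x : ∀ {n x} → b + suc n ≤ x → n + a * b < a * x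
  n+ab<a*x {n} {x} le = begin-strict
    n + a * b         ≡⟨ +-comm n (a * b) ⟩
    a * b + n         <⟨ +-monoʳ-< (a * b) (m≤n*m (suc n) a) ⟩
    a * b + a * suc n ≡⟨ *-distribˡ-+ a b (suc n) ⟨
    a * (b + suc n)   ≤⟨ *-monoʳ-≤ a le ⟩
    a * x             ∎
    where open ≤-Reasoning

  reps₂-+ab : ∀ n → reps₂ a b (n + a * b) ≡ suc (reps₂ a b n)
  reps₂-+ab n = begin
    ∑ (suc N) h
      ≡⟨ ∑-extend h bound (λ x le → 𝟙-no _ (λ sol → <⇒≱ (n+ab<a*x le) (≼⇒≤ sol))) ⟩
    ∑ (b + suc n) h                           ≡⟨ ∑-split b (suc n) h ⟩
    ∑ b h + ∑ (suc n) (λ x → h (b + x))       ≡⟨ cong₂ _+_ (∑<b-solvable≡1 N (m≤n+m (a * b) n))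
                                                   (∑-cong (suc n) λ x _ → 𝟙-cong _ _ (shifted x)) ⟩
    1 + reps₂ a b n                           ∎
    where
    open ≡-Reasoning
    N : ℕ
    N = n + a * b
    h : ℕ → ℕ
    h x = 𝟙 (a * x ≼[ b ]? N)
    bound : b + suc n ≤ suc N
    bound = ≤-trans (≤-reflexive (+-suc b n))
              (s≤s (≤-trans (≤-reflexive (+-comm b n)) (+-monoʳ-≤ n (m≤n*m b a))))
    shifted : ∀ x → a * (b + x) ≼[ b ] N ⇔ a * x ≼[ b ] n
    shifted x = subst (λ k → k ≼[ b ] N ⇔ a * x ≼[ b ] n) (distrib a b x) (≼-+ʳ (a * b))
      where
      distrib : ∀ a b x → a * x + a * b ≡ a * (b + x)
      distrib = solve-∀

  reps₂-<ab-≤1 : ∀ {n} → n < a * b → reps₂ a b n ≤ 1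
  reps₂-<ab-≤1 {n} n<ab = ∑𝟙-≤1 (λ x → a * x ≼[ b ]? n) (suc n) λ i j _ _ sᵢ sⱼ →
    coprime-cancel-mod coprime (below-b sᵢ) (below-b sⱼ)
      (≡-mod-trans (≼⇒≡-mod sᵢ) (≡-mod-sym (≼⇒≡-mod sⱼ)))
    where
    below-b : ∀ {x} → a * x ≼[ b ] n → x < b
    below-b {x} sol = *-cancelˡ-< a x b (≤-<-trans (≼⇒≤ sol) n<ab)

  reps₂-pos : ∀ {n} → a * b < n + a + b → 1 ≤ reps₂ a b n
  reps₂-pos {n} ab<n+a+b with coprime-residue coprime n
  ... | x₀ , x₀<b , ax₀≡n with ≡-mod⇒≼⊎+≤ ax₀≡n
  ...   | inj₁ sol       =
    ∑𝟙-pos (λ x → a * x ≼[ b ]? n) (suc n) (s≤s (≤-trans (m≤n*m x₀ a) (≼⇒≤ sol))) sol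
  ...   | inj₂ n+b≤ax₀  = contradiction ab<n+a+b (≤⇒≯ (begin
    n + a + b     ≡⟨ regroup n a b ⟩
    a + (n + b)   ≤⟨ +-monoʳ-≤ a n+b≤ax₀ ⟩
    a + a * x₀    ≡⟨ *-suc a x₀ ⟨
    a * suc x₀    ≤⟨ *-monoʳ-≤ a x₀<b ⟩
    a * b         ∎))
    where
    open ≤-Reasoning
    regroup : ∀ n a b → n + a + b ≡ a + (n + b)
    regroup = solve-∀

  reps₂-frobenius : ∀ {n} → n + a + b ≡ a * b → reps₂ a b n ≡ 0
  reps₂-frobenius {n} n+a+b≡ab = ∑𝟙-none (λ x → a * x ≼[ b ]? n) (suc n) λ x _ (by-multiple y eq) →
    let key : b * suc y + a * suc x ≡ a * b
        key = trans (expand a b x y) (trans (cong (λ k → k + a + b) eq) n+a+b≡ab)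
        b≤1+x : b ≤ suc x
        b≤1+x = ∣⇒≤ (coprime-divisor (Cop.sym coprime)
                  (∣m+n∣m⇒∣n (subst (b ∣_) (sym key) (divides a refl)) (divides (suc y) (*-comm b (suc y)))))
    in <-irrefl refl (begin-strict
      a * b             ≤⟨ *-monoʳ-≤ a b≤1+x ⟩
      a * suc x         <⟨ m<n+m (a * suc x) (≤-trans (>-nonZero⁻¹ b) (m≤m*n b (suc y))) ⟩
      b * suc y + a * suc x ≡⟨ key ⟩
      a * b             ∎)
    where
    open ≤-Reasoning
    expand : ∀ a b x y → b * suc y + a * suc x ≡ b * y + a * x + a + b
    expand = solve-∀

  0<ab+x : ∀ x → 0 < a * b + x
  0<ab+x x = ≤-trans (>-nonZero⁻¹ (a * b)) (m≤m+n (a * b) x)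

  reps₂-+k·ab : ∀ n k → reps₂ a b (n + k * (a * b)) ≡ k + reps₂ a b n
  reps₂-+k·ab n zero    = cong (reps₂ a b) (+-identityʳ n)
  reps₂-+k·ab n (suc k) = begin
    reps₂ a b (n + (a * b + k * (a * b))) ≡⟨ cong (reps₂ a b) (+-comm-middle n (a * b) (k * (a * b))) ⟩
    reps₂ a b (n + k * (a * b) + a * b)   ≡⟨ reps₂-+ab (n + k * (a * b)) ⟩
    suc (reps₂ a b (n + k * (a * b)))     ≡⟨ cong suc (reps₂-+k·ab n k) ⟩
    suc k + reps₂ a b n                   ∎
    where
    open ≡-Reasoning
    +-comm-middle : ∀ n p q → n + (p + q) ≡ n + q + p
    +-comm-middle = solve-∀

  n<ab⇒n+a+b≤2ab : ∀ {n} → n < a * b → n + a + b ≤ a * b + a * b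
  n<ab⇒n+a+b≤2ab {n} n<ab = begin
    n + a + b         ≡⟨ +-assoc n a b ⟩
    n + (a + b)       ≤⟨ +-monoʳ-≤ n (m+n≤m*n+1 a b) ⟩
    n + (a * b + 1)   ≡⟨ trans (cong (n +_) (+-comm (a * b) 1)) (+-suc n (a * b)) ⟩
    suc n + a * b     ≤⟨ +-monoˡ-≤ (a * b) n<ab ⟩
    a * b + a * b     ∎
    where open ≤-Reasoning

  n≮ab⇒∃[n′]n≡n′+ab : ∀ {n} → n ≮ a * b → ∃[ n′ ] n ≡ n′ + a * b
  n≮ab⇒∃[n′]n≡n′+ab n≮ab = m≤n⇒∃[o]n≡o+m (≮⇒≥ n≮ab)

  n+ab+a+b≡n+a+b+ab : ∀ n → n + a * b + a + b ≡ n + a + b + a * b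
  n+ab+a+b≡n+a+b+ab n = shuffle n (a * b) a b
    where
    shuffle : ∀ n p a b → n + p + a + b ≡ n + a + b + p
    shuffle = solve-∀

  reps₂-level : ∀ k {n} → n + a + b ≡ suc k * (a * b) → reps₂ a b n ≡ k
  reps₂-level zero    eq = reps₂-frobenius (trans eq (*-identityˡ (a * b)))
  reps₂-level (suc k) {n} eq with n <? a * b
  ... | no n≮ab with n≮ab⇒∃[n′]n≡n′+ab n≮ab
  ...   | n′ , refl = trans (reps₂-+ab n′) (cong suc (reps₂-level k (+-cancelʳ-≡ (a * b) _ _
                        (trans (sym (n+ab+a+b≡n+a+b+ab n′)) (trans eq (+-comm (a * b) (suc k * (a * b))))))))
  reps₂-level (suc zero) {n} eq | yes n<ab = ≤-antisym (reps₂-<ab-≤1 n<ab)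
    (reps₂-pos (subst (a * b <_) (sym eq) (m<m+n (a * b) (0<ab+x 0))))
  reps₂-level (suc (suc k)) {n} eq | yes n<ab = contradiction (n<ab⇒n+a+b≤2ab n<ab) (<⇒≱ (begin-strict
    a * b + a * b                   <⟨ +-monoʳ-< (a * b) (m<m+n (a * b) (0<ab+x (k * (a * b)))) ⟩
    a * b + (a * b + suc k * (a * b)) ≡⟨ eq ⟨
    n + a + b                        ∎))
    where open ≤-Reasoning

  reps₂-above-level : ∀ k {n} → suc k * (a * b) < n + a + b → k < reps₂ a b n
  reps₂-above-level zero {n} lt = reps₂-pos (subst (_< n + a + b) (*-identityˡ (a * b)) lt)
  reps₂-above-level (suc k) {n} lt with n <? a * b
  ... | yes n<ab = contradiction (n<ab⇒n+a+b≤2ab n<ab)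
                     (<⇒≱ (≤-<-trans (+-monoʳ-≤ (a * b) (m≤m+n (a * b) (k * (a * b)))) lt))
  ... | no n≮ab with n≮ab⇒∃[n′]n≡n′+ab n≮ab
  ...   | n′ , refl = subst (suc k <_) (sym (reps₂-+ab n′)) (s≤s (reps₂-above-level k (+-cancelʳ-< _ _ _
                        (subst₂ _<_ (+-comm (a * b) (suc k * (a * b))) (n+ab+a+b≡n+a+b+ab n′) lt))))

  reps₂-below-multiple : ∀ k {n} → n < k * (a * b) → reps₂ a b n ≤ k
  reps₂-below-multiple (suc k) {n} lt with n <? a * b
  ... | yes n<ab = ≤-trans (reps₂-<ab-≤1 n<ab) (s≤s z≤n)
  ... | no n≮ab with n≮ab⇒∃[n′]n≡n′+ab n≮ab
  ...   | n′ , refl = subst (_≤ suc k) (sym (reps₂-+ab n′))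
      (s≤s (reps₂-below-multiple k (+-cancelʳ-< _ _ _ (subst (n′ + a * b <_) (+-comm (a * b) (k * (a * b))) lt))))

module ProductTriple (a b m : ℕ) .{{_ : NonZero a}} .{{_ : NonZero b}} .{{_ : NonZero m}} (coprime : Coprime a b) where

  open TwoGenerators a b coprime

  L : ℕ
  L = m * a * b

  reps₃ : ℕ → ℕ
  reps₃ = repsℕ a b L

  private instance
    L≢0 : NonZero L
    L≢0 = m*n≢0 (m * a) b {{m*n≢0 m a}}

  open ThreeGenerators a b L

  reps₂-+L : ∀ M → reps₂ a b (M + L) ≡ m + reps₂ a b M
  reps₂-+L M = trans (cong (λ l → reps₂ a b (M + l)) (*-assoc m a b)) (reps₂-+k·ab M m)

  reps₂-<L : ∀ {M} → M < L → reps₂ a b M ≤ m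
  reps₂-<L {M} M<L = reps₂-below-multiple m (subst (M <_) (*-assoc m a b) M<L)

  reps₃-+L : ∀ M → reps₃ (M + L) ≡ m + reps₂ a b M + reps₃ M
  reps₃-+L M = trans (repsℕ-step M) (cong (_+ reps₃ M) (reps₂-+L M))

  <L⊎+L : ∀ M → M < L ⊎ ∃[ M′ ] M ≡ M′ + L
  <L⊎+L M with M <? L
  ... | yes M<L = inj₁ M<L
  ... | no M≮L  = inj₂ (m≤n⇒∃[o]n≡o+m (≮⇒≥ M≮L))

  reps₂≤reps₃ : ∀ M → reps₂ a b M ≤ reps₃ M
  reps₂≤reps₃ M with <L⊎+L M
  ... | inj₁ M<L         = ≤-reflexive (sym (repsℕ-below M<L))
  ... | inj₂ (M′ , refl) = ≤-trans (m≤m+n _ _) (≤-reflexive (sym (repsℕ-step M′)))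

  reps₃-vanishes : ∀ {M} → reps₂ a b M ≡ 0 → reps₃ M ≡ 0
  reps₃-vanishes {M} r≡0 with <L⊎+L M
  ... | inj₁ M<L         = trans (repsℕ-below M<L) r≡0
  ... | inj₂ (M′ , refl) = contradiction (trans (sym (reps₂-+L M′)) r≡0) (m+n≢0 m)
    where
    m+n≢0 : ∀ m {n} .{{_ : NonZero m}} → m + n ≢ 0
    m+n≢0 (suc _) ()

  reps₃≡reps₂ : ∀ {M} → reps₂ a b M ≤ m → reps₃ M ≡ reps₂ a b M
  reps₃≡reps₂ {M} r≤m with <L⊎+L M
  ... | inj₁ M<L         = repsℕ-below M<L
  ... | inj₂ (M′ , refl) with reps₂ a b M′ in r′≡
  ...   | zero  = trans (repsℕ-step M′) (trans (cong (reps₂ a b (M′ + L) +_) (reps₃-vanishes r′≡)) (+-identityʳ _))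
  ...   | suc i = contradiction (subst (_≤ m) (trans (reps₂-+L M′) (cong (m +_) r′≡)) r≤m)
                    (<⇒≱ (m<m+n m z<s))

  reps₃-level : ∀ {k n} → k ≤ m → n + a + b ≡ suc k * (a * b) → reps₃ n ≡ k
  reps₃-level {k} {n} k≤m eq = trans (reps₃≡reps₂ (subst (_≤ m) (sym r≡k) k≤m)) r≡k
    where
    r≡k : reps₂ a b n ≡ k
    r≡k = reps₂-level k eq

  reps₃-level-2+m : ∀ {n} → n + a + b ≡ suc (suc m) * (a * b) → reps₃ n ≡ suc (suc m)
  reps₃-level-2+m {n} eq with <L⊎+L n
  ... | inj₁ n<L = contradiction (reps₂-<L n<L) (subst (_≰ m) (sym (reps₂-level (suc m) eq)) (<⇒≱ ≤-refl))
  ... | inj₂ (n′ , refl) = begin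
    reps₃ (n′ + L)              ≡⟨ repsℕ-step n′ ⟩
    reps₂ a b (n′ + L) + reps₃ n′ ≡⟨ cong₂ _+_ (reps₂-level (suc m) eq) (trans (reps₃≡reps₂ r′≤m) r′≡1) ⟩
    suc m + 1                   ≡⟨ +-comm (suc m) 1 ⟩
    suc (suc m)                 ∎
    where
    open ≡-Reasoning
    r′≡1 : reps₂ a b n′ ≡ 1
    r′≡1 = +-cancelˡ-≡ m _ _ (trans (sym (reps₂-+L n′)) (trans (reps₂-level (suc m) eq) (+-comm 1 m)))
    r′≤m : reps₂ a b n′ ≤ m
    r′≤m = ≤-trans (≤-reflexive r′≡1) (>-nonZero⁻¹ m)

  reps₃≢1+m : ∀ M → reps₃ M ≢ suc m
  reps₃≢1+m M with <L⊎+L M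
  ... | inj₁ M<L = λ eq → 1+n≰n (subst (_≤ m) (trans (sym (repsℕ-below M<L)) eq) (reps₂-<L M<L))
  ... | inj₂ (M′ , refl) with reps₂ a b M′ in r′≡
  ...   | zero  = λ eq → 1+n≢n (begin
    suc m                          ≡⟨ eq ⟨
    reps₃ (M′ + L)                 ≡⟨ reps₃-+L M′ ⟩
    m + reps₂ a b M′ + reps₃ M′    ≡⟨ cong₂ (λ r s → m + r + s) r′≡ (reps₃-vanishes r′≡) ⟩
    m + 0 + 0                      ≡⟨ trans (+-identityʳ (m + 0)) (+-identityʳ m) ⟩
    m                              ∎)
    where open ≡-Reasoning
  ...   | suc i = λ eq → 1+n≰n (begin
    suc (suc m)                    ≡⟨ trans (cong suc (+-comm 1 m)) (+-comm 1 (m + 1)) ⟩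
    m + 1 + 1                      ≤⟨ +-mono-≤ (+-monoʳ-≤ m (s≤s z≤n)) (≤-trans (s≤s z≤n) r′≤reps₃) ⟩
    m + suc i + reps₃ M′           ≡⟨ cong (λ r → m + r + reps₃ M′) r′≡ ⟨
    m + reps₂ a b M′ + reps₃ M′    ≡⟨ reps₃-+L M′ ⟨
    reps₃ (M′ + L)                 ≡⟨ eq ⟩
    suc m                          ∎)
    where
    open ≤-Reasoning
    r′≤reps₃ : suc i ≤ reps₃ M′
    r′≤reps₃ = subst (_≤ reps₃ M′) r′≡ (reps₂≤reps₃ M′)

  reps₃-above-level : ∀ j {M} → suc j * (a * b) < M + a + b → j < reps₃ M
  reps₃-above-level j {M} lt = <-≤-trans (reps₂-above-level j lt) (reps₂≤reps₃ M)

  reps₃-above-level-2+m : ∀ {M} → suc (suc m) * (a * b) < M + a + b → suc (suc m) < reps₃ M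
  reps₃-above-level-2+m {M} lt with <L⊎+L M
  ... | inj₁ M<L = contradiction (reps₂-<L M<L) (<⇒≱ (<-trans ≤-refl (reps₂-above-level (suc m) lt)))
  ... | inj₂ (M′ , refl) = begin-strict
    suc (suc m)                     <⟨ ≤-reflexive (+-comm 1 (suc (suc m))) ⟩
    suc (suc m) + 1
      ≤⟨ +-mono-≤ (reps₂-above-level (suc m) lt) (≤-trans r′≥1 (reps₂≤reps₃ M′)) ⟩
    reps₂ a b (M′ + L) + reps₃ M′   ≡⟨ repsℕ-step M′ ⟨
    reps₃ (M′ + L)                  ∎
    where
    open ≤-Reasoning
    r′≥1 : 1 ≤ reps₂ a b M′
    r′≥1 = +-cancelˡ-≤ m 1 _ (≤-trans (≤-trans (≤-reflexive (+-comm m 1)) (n≤1+n _))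
             (≤-trans (reps₂-above-level (suc m) lt) (≤-reflexive (reps₂-+L M′))))

  reps₃-greatest⇒level : ∀ {j n} → j ≤ m → reps₃ n ≡ j → (∀ M → reps₃ M ≡ j → M ≤ n) →
                         n + a + b ≡ suc j * (a * b)
  reps₃-greatest⇒level {j} {n} j≤m reps₃n≡j greatest = ≤-antisym upper lower
    where
    upper : n + a + b ≤ suc j * (a * b)
    upper = ≮⇒≥ λ lt → <⇒≢ (reps₃-above-level j lt) (sym reps₃n≡j)
    t : ℕ
    t = suc j * (a * b) ∸ (a + b)
    t+a+b : t + a + b ≡ suc j * (a * b)
    t+a+b = trans (+-assoc t a b)
      (m∸n+n≡m (≤-trans (≤-trans (m≤n+m (a + b) n) (≤-reflexive (sym (+-assoc n a b)))) upper))
    lower : suc j * (a * b) ≤ n + a + b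
    lower = subst (_≤ n + a + b) t+a+b (+-monoˡ-≤ b (+-monoˡ-≤ a (greatest t (reps₃-level j≤m t+a+b))))

  level-2+m : ∃[ t ] 0 < t × t + a + b ≡ suc (suc m) * (a * b)
  level-2+m = t , m<n⇒0<n∸m a+b<level , trans (+-assoc t a b) (m∸n+n≡m (<⇒≤ a+b<level))
    where
    a+b<level : a + b < suc (suc m) * (a * b)
    a+b<level = begin-strict
      a + b                     ≤⟨ m+n≤m*n+1 a b ⟩
      a * b + 1
        <⟨ +-monoʳ-< (a * b) (+-mono-≤ (>-nonZero⁻¹ (a * b)) (>-nonZero⁻¹ (m * (a * b)) {{m*n≢0 m (a * b)}})) ⟩
      a * b + (a * b + m * (a * b)) ∎
      where open ≤-Reasoning
    t : ℕ
    t = suc (suc m) * (a * b) ∸ (a + b)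

  reps₃-2+m-greatest : ∀ {t} → t + a + b ≡ suc (suc m) * (a * b) → ∀ M → reps₃ M ≡ suc (suc m) → M ≤ t
  reps₃-2+m-greatest {t} t+a+b≡ M reps₃M≡ = ≮⇒≥ λ t<M →
    <⇒≢ (reps₃-above-level-2+m (subst (_< M + a + b) t+a+b≡ (+-monoˡ-< b (+-monoˡ-< a t<M)))) (sym reps₃M≡)

  [k+i]*a*b≡[i+k]*ab : ∀ k i → (k + i) * a * b ≡ (i + k) * (a * b)
  [k+i]*a*b≡[i+k]*ab k i = trans (*-assoc (k + i) a b) (cong (_* (a * b)) (+-comm k i))

open import Data.Integer as ℤ using (ℤ; +_; -[1+_])
import Data.Integer.Properties as ℤ
import Data.Integer.Tactic.RingSolver as ℤ-Solver

module _ {b₁ b₂ b₃ j : ℕ} where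

  IsG-greatest : ∀ {t} → 0 < t → repsℕ b₁ b₂ b₃ t ≡ j → (∀ M → repsℕ b₁ b₂ b₃ M ≡ j → M ≤ t) →
                 IsG b₁ b₂ b₃ j (+ t)
  IsG-greatest 0<t reps≡j greatest =
    inj₁ (ℤ.+<+ 0<t , reps≡j , λ { (+ M) eq → ℤ.+≤+ (greatest M eq) ; -[1+ _ ] _ → ℤ.-≤+ })

  IsG-none : (∀ M → repsℕ b₁ b₂ b₃ M ≢ j) → IsG b₁ b₂ b₃ j (+ 0)
  IsG-none ≢j = inj₂ (refl , λ { (+ M) _ → ≢j M ; -[1+ _ ] () })

  IsG-positive : ∀ {g} → IsG b₁ b₂ b₃ j g → g ≢ + 0 →
                 ∃[ n ] g ≡ + n × repsℕ b₁ b₂ b₃ n ≡ j × (∀ M → repsℕ b₁ b₂ b₃ M ≡ j → M ≤ n)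
  IsG-positive         (inj₂ (g≡0 , _)) g≢0 = contradiction g≡0 g≢0
  IsG-positive {+ n}   (inj₁ (_ , reps≡j , greatest)) _ =
    n , refl , reps≡j , λ M eq → ℤ.drop‿+≤+ (greatest (+ M) eq)
  IsG-positive { -[1+ _ ]} (inj₁ (() , _)) _

+-−-cancelʳ : ∀ {t a b A} → t + a + b ≡ A → + A ℤ.- + a ℤ.- + b ≡ + t
+-−-cancelʳ {t} {a} {b} refl = begin
  + (t + a + b) ℤ.- + a ℤ.- + b
    ≡⟨ cong (λ z → z ℤ.- + a ℤ.- + b) (trans (ℤ.pos-+ (t + a) b) (cong (ℤ._+ + b) (ℤ.pos-+ t a))) ⟩
  + t ℤ.+ + a ℤ.+ + b ℤ.- + a ℤ.- + b     ≡⟨ cancel (+ t) (+ a) (+ b) ⟩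
  + t                                     ∎
  where
  open ≡-Reasoning
  cancel : ∀ x y z → x ℤ.+ y ℤ.+ z ℤ.- y ℤ.- z ≡ x
  cancel = ℤ-Solver.solve-∀

corollary1 : (a₁ a₂ m : ℕ) → NonZero a₁ → NonZero a₂ → NonZero m → Coprime a₁ a₂ →
    (j : ℕ) (g : ℤ) → IsG a₁ a₂ (m * a₁ * a₂) j g → g ≢ + 0 →
      ((j < m + 1 → g ≡ (+ ((j + 1) * a₁ * a₂)) ℤ.- (+ a₁) ℤ.- (+ a₂))
      × IsG a₁ a₂ (m * a₁ * a₂) (m + 1) (+ 0)
      × IsG a₁ a₂ (m * a₁ * a₂) (m + 2) ((+ ((m + 2) * a₁ * a₂)) ℤ.- (+ a₁) ℤ.- (+ a₂)))
corollary1 a₁ a₂ m nz₁ nz₂ nzₘ coprime j g isG g≢0 = part-i , part-ii , part-iii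
  where
  instance
    a₁≢0 : NonZero a₁
    a₁≢0 = nz₁
    a₂≢0 : NonZero a₂
    a₂≢0 = nz₂
    m≢0 : NonZero m
    m≢0 = nzₘ
  open ProductTriple a₁ a₂ m coprime

  part-i : j < m + 1 → g ≡ (+ ((j + 1) * a₁ * a₂)) ℤ.- (+ a₁) ℤ.- (+ a₂)
  part-i j<m+1 with IsG-positive isG g≢0
  ... | n , refl , reps₃n≡j , greatest = sym (+-−-cancelʳ (trans
          (reps₃-greatest⇒level (s≤s⁻¹ (subst (j <_) (+-comm m 1) j<m+1)) reps₃n≡j greatest)
          (sym ([k+i]*a*b≡[i+k]*ab j 1))))

  part-ii : IsG a₁ a₂ (m * a₁ * a₂) (m + 1) (+ 0)
  part-ii = IsG-none λ M eq → reps₃≢1+m M (trans eq (+-comm m 1))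

  part-iii : IsG a₁ a₂ (m * a₁ * a₂) (m + 2) ((+ ((m + 2) * a₁ * a₂)) ℤ.- (+ a₁) ℤ.- (+ a₂))
  part-iii with level-2+m
  ... | t , 0<t , t+a+b≡ = subst (IsG a₁ a₂ (m * a₁ * a₂) (m + 2))
          (sym (+-−-cancelʳ (trans t+a+b≡ (sym ([k+i]*a*b≡[i+k]*ab m 2)))))
          (IsG-greatest 0<t (trans (reps₃-level-2+m t+a+b≡) (+-comm 2 m))
            λ M eq → reps₃-2+m-greatest t+a+b≡ M (trans eq (+-comm m 2)))
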